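{- Let $\Gamma$ be a finite graph that is locally $n\times n$ grid with $n\geq 3$. Let $x$ be a vertex and $C$ a maximal clique of $\Gamma$ with $d_\Gamma(x,C)\in\{1,2\}$, and let \[ S=\{w\in\Gamma(x) : w\notin C \text{ and } w\in\Gamma(y)\text{ for some } y\in C\cap\Gamma_2(x)\}. \] Then \[ 2|S| = \sum_{y\in C\cap\Gamma_2(x)} c_2(x,y) \equiv 0 \pmod 4. \]
   Context: A graph is locally $n\times n$ grid if the induced subgraph on every vertex neighbourhood $\Gamma(x)$ is isomorphic to $K_n\square K_n$ (vertices $(i,j)$, $1\le i,j\le n$, adjacent iff they agree in exactly one coordinate). $\Gamma_2(x)$ is the set of vertices at distance $2$ from $x$; $c_2(x,y)=|\Gamma(x)\cap\Gamma(y)|$; $d_\Gamma(x,C)=\min_{z\in C}d_\Gamma(x,z)$. -}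

module Defs where

open import Data.Nat using (ℕ; zero; suc; _+_; _*_)
open import Data.Bool using (Bool; true; false; _∧_; _∨_; not; if_then_else_)
open import Data.Fin using (Fin; _≟_)
open import Data.Fin.Properties using ()
open import Data.List using (List; map; allFin)
open import Data.Nat.ListAction using (sum)
open import Data.Bool.ListAction using (any)
open import Data.Fin using (Fin; _≟_)
open import Data.Product using (Σ; _×_; _,_; ∃)
open import Data.Sum using (_⊎_)
open import Relation.Nullary using (¬_; ⌊_⌋)
open import Relation.Binary.PropositionalEquality using (_≡_; _≢_)

record Graph : Set where
  field
    N     : ℕ
    adj   : Fin N → Fin N → Bool
    sym   : ∀ u v → adj u v ≡ adj v u
    irrefl : ∀ v → adj v v ≡ false

module _ (G : Graph) where
  open Graph G

  Adj : Fin N → Fin N → Set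
  Adj u v = adj u v ≡ true

  count : (Fin N → Bool) → ℕ
  count P = sum (map (λ v → if P v then 1 else 0) (allFin N))

  Σv : (Fin N → ℕ) → ℕ
  Σv f = sum (map f (allFin N))

  inΓ₂ : Fin N → Fin N → Bool
  inΓ₂ x y = not ⌊ x ≟ y ⌋ ∧ not (adj x y) ∧ any (λ w → adj x w ∧ adj w y) (allFin N)

  c₂ : Fin N → Fin N → ℕ
  c₂ x y = count (λ w → adj x w ∧ adj y w)

  IsClique : (Fin N → Bool) → Set
  IsClique C = ∀ u v → C u ≡ true → C v ≡ true → u ≢ v → Adj u v

  IsMaximalClique : (Fin N → Bool) → Set
  IsMaximalClique C = IsClique C ×
    (∀ v → C v ≡ false → ¬ (∀ u → C u ≡ true → Adj v u))

  Dist0 Dist1 Dist2 : Fin N → Fin N → Set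
  Dist0 x z = x ≡ z
  Dist1 x z = Adj x z
  Dist2 x z = inΓ₂ x z ≡ true

  DistToCliqueIn12 : Fin N → (Fin N → Bool) → Set
  DistToCliqueIn12 x C =
    (∀ z → C z ≡ true → x ≢ z) ×
    (∃ λ z → C z ≡ true × (Dist1 x z ⊎ Dist2 x z))

  inS : Fin N → (Fin N → Bool) → Fin N → Bool
  inS x C w = adj x w ∧ not (C w) ∧ any (λ y → C y ∧ inΓ₂ x y ∧ adj w y) (allFin N)

  sumC₂ : Fin N → (Fin N → Bool) → ℕ
  sumC₂ x C = Σv (λ y → if C y ∧ inΓ₂ x y then c₂ x y else 0)

-- adjacency in K_n □ K_n: agree in exactly one coordinate
GridAdj : ∀ {n} → Fin n × Fin n → Fin n × Fin n → Set
GridAdj (i , j) (i' , j') = (i ≡ i' × j ≢ j') ⊎ (i ≢ i' × j ≡ j')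

-- Γ(x) induces a subgraph isomorphic to K_n □ K_n: a bijection
-- φ : [n]×[n] → Γ(x) preserving and reflecting adjacency.
LocallyGrid : ℕ → Graph → Set
LocallyGrid n G = ∀ x → Σ (Fin n × Fin n → Fin N) λ φ →
    (∀ p q → φ p ≡ φ q → p ≡ q)
  × (∀ p → Adj G x (φ p))
  × (∀ v → Adj G x v → ∃ λ p → φ p ≡ v)
  × (∀ p q → (Adj G (φ p) (φ q) → GridAdj p q) × (GridAdj p q → Adj G (φ p) (φ q)))
  where open Graph G

module Submission where

-- Let x be a vertex outside a maximal clique C of a graph that is locally K_n □ K_n, and put
-- A = C ∩ Γ(x), D = C ∩ Γ₂(x), and S as in the statement.  The proof is a double count.
--
-- Every maximal clique of K_n □ K_n is a row or a column, two distinct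
--    non-adjacent cells have exactly two common neighbours, and a cell apart from an edge has
--    exactly one common neighbour with both of its ends.
--  * Local structure.  For y ∈ C the vertices of C ∩ Γ(y) form a full row of a chart of Γ(y);
--    hence a vertex outside C adjacent to C has exactly two neighbours in C.  So |A| ∈ {0,2},
--    and S splits into S_A (one neighbour in A, one in D) and S_D (two neighbours in D).
--  * Counting.  With τ(w) = |D ∩ Γ(w)| for w ∈ Γ(x), Σ_{y∈D} c₂(x,y) = Σ_w τ(w), and locally
--    τ(w) + [w ∈ S_A] = [w ∈ A]·|D| + 2·[w ∈ S].  Each a ∈ A and y ∈ D have exactly one
--    common neighbour in Γ(x) \ C, which gives |S_A| = |A|·|D|; summing, Σ c₂ = 2|S|.
--  * Parity.  Each w ∈ S_D has exactly one partner in S_D (the apex of x, y₀, y₁ in the chart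
--    of w), so |S_D| is even, and 2|S| = 2(|A|·|D| + |S_D|) is divisible by 4.

open import Defs
open import Data.Nat using (ℕ; zero; suc; _+_; _*_; _≤_; s≤s)
open import Data.Nat.Properties using (+-*-semiring; +-identityʳ; *-zeroʳ; +-comm; +-cancelˡ-≡; <⇒≤)
open import Data.Nat.Tactic.RingSolver using (solve-∀)
open import Data.Nat.Divisibility using (_∣_; divides)
open import Data.Bool using (Bool; true; false; _∧_; not; if_then_else_)
open import Data.Bool.Properties using (T-≡) renaming (_≟_ to _≟ᵇ_)
open import Data.Bool.ListAction using (any)
open import Data.Fin using (Fin; zero; suc; _≟_; punchIn)
open import Data.Fin.Properties using (0≢1+n; suc-injective; punchInᵢ≢i; any?; <-cmp; <-asym; _<?_)
open import Data.List using (map; allFin; tabulate)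
open import Data.List.Properties using (map-tabulate)
open import Data.List.Relation.Unary.Any using (satisfied)
open import Data.List.Relation.Unary.Any.Properties using (any⁺; any⁻)
open import Data.List.Membership.Propositional using (lose)
open import Data.List.Membership.Propositional.Properties using (∈-allFin)
import Data.Nat.ListAction as List
open import Data.Product using (∃; ∃!; _×_; _,_; proj₁; proj₂)
open import Data.Product.Properties using (≡-dec)
open import Data.Sum using (_⊎_; inj₁; inj₂; swap)
open import Data.Empty using (⊥-elim)
open import Function using (case_of_)
open import Function.Bundles using (Equivalence)
open import Relation.Nullary using (¬_; ⌊_⌋; does; yes; no)
open import Relation.Nullary.Decidable using (Dec; isYes≗does; dec-true; dec-false; _×-dec_; ¬?)
open import Relation.Binary.Definitions using (tri<; tri≈; tri>)
open import Relation.Binary.PropositionalEquality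
open import Algebra.Properties.Semiring.Sum +-*-semiring
  using (sum-syntax; sum-cong-≗; sum-replicate-zero; ∑-distrib-+; ∑-comm; *-distribˡ-sum; *-distribʳ-sum)

false≢true : false ≢ true
false≢true ()

not-true : ∀ {b} → b ≢ true → b ≡ false
not-true {false} _   = refl
not-true {true}  b≢t = ⊥-elim (b≢t refl)

∧-intro : ∀ {a b} → a ≡ true → b ≡ true → a ∧ b ≡ true
∧-intro refl refl = refl

∧-elim : ∀ {a b} → a ∧ b ≡ true → a ≡ true × b ≡ true
∧-elim {true} b≡true = refl , b≡true

not-intro : ∀ {a} → a ≡ false → not a ≡ true
not-intro refl = refl

not-elim : ∀ {a} → not a ≡ true → a ≡ false
not-elim {false} _ = refl

≡-from-⇔ : ∀ {a b} → (a ≡ true → b ≡ true) → (b ≡ true → a ≡ true) → a ≡ b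
≡-from-⇔ {false} {false} _ _ = refl
≡-from-⇔ {false} {true}  _ b⇒a = b⇒a refl
≡-from-⇔ {true}  {false} a⇒b _ = sym (a⇒b refl)
≡-from-⇔ {true}  {true}  _ _ = refl

any-witness : ∀ {N} (f : Fin N → Bool) → any f (allFin N) ≡ true → ∃ λ v → f v ≡ true
any-witness {N} f any≡true =
  let (v , Tfv) = satisfied (any⁻ f (allFin N) (Equivalence.from T-≡ any≡true)) in v , Equivalence.to T-≡ Tfv

any-intro : ∀ {N} (f : Fin N → Bool) v → f v ≡ true → any f (allFin N) ≡ true
any-intro f v fv = Equivalence.to T-≡ (any⁺ f (lose (∈-allFin v) (Equivalence.from T-≡ fv)))

ind : Bool → ℕ
ind b = if b then 1 else 0

#_ : ∀ {N} → (Fin N → Bool) → ℕ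
#_ {N} P = ∑[ v < N ] ind (P v)

infix 10 #_

sum-allFin : ∀ N (f : Fin N → ℕ) → List.sum (map f (allFin N)) ≡ ∑[ v < N ] f v
sum-allFin N f = trans (cong List.sum (map-tabulate (λ v → v) f)) (sum-tabulate N f)
  where
  sum-tabulate : ∀ N (f : Fin N → ℕ) → List.sum (tabulate f) ≡ ∑[ v < N ] f v
  sum-tabulate zero    f = refl
  sum-tabulate (suc N) f = cong (f zero +_) (sum-tabulate N (λ v → f (suc v)))

#-none : ∀ {N} (P : Fin N → Bool) → (∀ v → P v ≢ true) → # P ≡ 0
#-none {zero}  P none = refl
#-none {suc N} P none with P zero in e
... | true  = ⊥-elim (none zero e)
... | false = #-none (λ v → P (suc v)) (λ v → none (suc v))

#-unique : ∀ {N} (P : Fin N → Bool) → ∃! _≡_ (λ v → P v ≡ true) → # P ≡ 1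
#-unique {suc N} P (zero , holds , unique) rewrite holds =
  cong suc (#-none (λ v → P (suc v)) (λ v p → 0≢1+n (unique p)))
#-unique {suc N} P (suc w , holds , unique) with P zero in e
... | true  = ⊥-elim (0≢1+n (sym (unique e)))
... | false = #-unique (λ v → P (suc v)) (w , holds , λ p → suc-injective (unique p))

#-cong : ∀ {N} {P Q : Fin N → Bool} → (∀ v → P v ≡ Q v) → # P ≡ # Q
#-cong P≗Q = sum-cong-≗ (λ v → cong ind (P≗Q v))

#-split : ∀ {N} (P Q : Fin N → Bool) → # P ≡ # (λ v → P v ∧ Q v) + # (λ v → P v ∧ not (Q v))
#-split P Q = trans (sum-cong-≗ split-ind) (∑-distrib-+ (λ v → ind (P v ∧ Q v)) (λ v → ind (P v ∧ not (Q v))))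
  where
  split-ind : ∀ v → ind (P v) ≡ ind (P v ∧ Q v) + ind (P v ∧ not (Q v))
  split-ind v with P v | Q v
  ... | true  | true  = refl
  ... | true  | false = refl
  ... | false | _     = refl

#-pair : ∀ {N} (P : Fin N → Bool) (a b : Fin N) → P a ≡ true → P b ≡ true → a ≢ b →
         (∀ v → P v ≡ true → v ≡ a ⊎ v ≡ b) → # P ≡ 2
#-pair P a b Pa Pb a≢b only-a-b = trans (#-split P (λ v → does (v ≟ a)))
  (cong₂ _+_ (#-unique _ (a , at-a , is-a)) (#-unique _ (b , at-b , is-b)))
  where
  at-a : P a ∧ does (a ≟ a) ≡ true
  at-a rewrite Pa | dec-true (a ≟ a) refl = refl
  at-b : P b ∧ not (does (b ≟ a)) ≡ true
  at-b rewrite Pb | dec-false (b ≟ a) (λ b≡a → a≢b (sym b≡a)) = refl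
  is-a : ∀ {v} → P v ∧ does (v ≟ a) ≡ true → a ≡ v
  is-a {v} p with P v | v ≟ a
  is-a {v} () | false | _
  is-a {v} refl | true | yes v≡a = sym v≡a
  is-b : ∀ {v} → P v ∧ not (does (v ≟ a)) ≡ true → b ≡ v
  is-b {v} p with P v in e | v ≟ a
  is-b {v} () | false | _
  is-b {v} refl | true | no v≢a with only-a-b v e
  ... | inj₁ v≡a = ⊥-elim (v≢a v≡a)
  ... | inj₂ v≡b = sym v≡b

#-pairs : ∀ {M N} (P : Fin M → Bool) (Q : Fin N → Bool) →
          ∑[ a < M ] ∑[ b < N ] ind (P a ∧ Q b) ≡ # P * # Q
#-pairs {M} {N} P Q = begin
  ∑[ a < M ] ∑[ b < N ] ind (P a ∧ Q b)       ≡⟨ sum-cong-≗ (λ a → sum-cong-≗ (λ b → ind-∧ (P a) (Q b))) ⟩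
  ∑[ a < M ] ∑[ b < N ] (ind (P a) * ind (Q b)) ≡⟨ sum-cong-≗ (λ a → sym (*-distribˡ-sum (ind (P a)) (λ b → ind (Q b)))) ⟩
  ∑[ a < M ] (ind (P a) * # Q)                 ≡⟨ sym (*-distribʳ-sum (# Q) (λ a → ind (P a))) ⟩
  # P * # Q                                    ∎
  where
  open ≡-Reasoning
  ind-∧ : ∀ a b → ind (a ∧ b) ≡ ind a * ind b
  ind-∧ false b = refl
  ind-∧ true  b = sym (+-identityʳ (ind b))

ind-as-# : ∀ {N} (b : Bool) (R : Fin N → Bool) → (b ≡ true → ∃! _≡_ (λ v → R v ≡ true)) →
           (∀ v → R v ≡ true → b ≡ true) → ind b ≡ # R
ind-as-# true  R unique-R R⇒b = sym (#-unique R (unique-R refl))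
ind-as-# false R unique-R R⇒b = sym (#-none R (λ v Rv → false≢true (R⇒b v Rv)))

-- A symmetric irreflexive relation has an even number of ordered pairs: each unordered
-- pair {w,v} is counted once with w < v and once with v < w.
symmetric-pairs-even : ∀ {N} (E : Fin N → Fin N → Bool) → (∀ w v → E w v ≡ E v w) → (∀ w → E w w ≡ false) →
                       ∃ λ K → ∑[ w < N ] # E w ≡ K + K
symmetric-pairs-even {N} E E-sym E-irrefl = ∑[ w < N ] # below w , (begin
    ∑[ w < N ] # E w                                   ≡⟨ sum-cong-≗ (λ w → sum-cong-≗ (split w)) ⟩
    ∑[ w < N ] ∑[ v < N ] (ind (below w v) + ind (below v w))
                                                       ≡⟨ sum-cong-≗ (λ w → ∑-distrib-+ (λ v → ind (below w v)) (λ v → ind (below v w))) ⟩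
    ∑[ w < N ] (# below w + ∑[ v < N ] ind (below v w)) ≡⟨ ∑-distrib-+ (λ w → # below w) (λ w → ∑[ v < N ] ind (below v w)) ⟩
    ∑[ w < N ] # below w + ∑[ w < N ] ∑[ v < N ] ind (below v w)
                                                       ≡⟨ cong (∑[ w < N ] # below w +_) (∑-comm (λ w v → ind (below v w))) ⟩
    ∑[ w < N ] # below w + ∑[ w < N ] # below w        ∎)
  where
  open ≡-Reasoning
  below : Fin N → Fin N → Bool
  below w v = E w v ∧ does (w <? v)
  split : ∀ w v → ind (E w v) ≡ ind (below w v) + ind (below v w)
  split w v with <-cmp w v
  ... | tri< w<v _ _ rewrite dec-true (w <? v) w<v | dec-false (v <? w) (<-asym w<v) | E-sym v w
    with E w v
  ...   | true  = refl
  ...   | false = refl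
  split w v | tri> _ _ v<w rewrite dec-true (v <? w) v<w | dec-false (w <? v) (<-asym v<w) | E-sym v w
    with E w v
  ...   | true  = refl
  ...   | false = refl
  split w v | tri≈ _ refl _ rewrite E-irrefl w = refl

perfect-matching-even : ∀ {N} (P : Fin N → Bool) (E : Fin N → Fin N → Bool) →
  (∀ w v → E w v ≡ E v w) → (∀ w → E w w ≡ false) →
  (∀ w → P w ≡ true → ∃! _≡_ (λ v → E w v ≡ true)) → (∀ w v → E w v ≡ true → P w ≡ true) →
  ∃ λ K → # P ≡ K + K
perfect-matching-even P E E-sym E-irrefl partner matched =
  let (K , pairs≡K+K) = symmetric-pairs-even E E-sym E-irrefl
  in K , trans (sum-cong-≗ (λ w → ind-as-# (P w) (E w) (partner w) (matched w))) pairs≡K+K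

index : ∀ {n} → 2 ≤ n → Fin n
index (s≤s _) = zero

another : ∀ {n} → 2 ≤ n → (j : Fin n) → ∃ λ j' → j' ≢ j
another (s≤s (s≤s _)) j = punchIn j zero , punchInᵢ≢i j zero

-- The rook's graph K_n □ K_n on cells (row , column).
Cell : ℕ → Set
Cell n = Fin n × Fin n

module Grid {n : ℕ} where

  find : ∀ {P : Cell n → Set} → (∀ p → Dec (P p)) → (∃ P) ⊎ (∀ p → ¬ P p)
  find P? with any? (λ i → any? (λ j → P? (i , j)))
  ... | yes (i , j , Pij) = inj₁ ((i , j) , Pij)
  ... | no  none          = inj₂ (λ (i , j) Pij → none (i , j , Pij))

  transpose : Cell n → Cell n
  transpose (i , j) = (j , i)

  transpose-adj : ∀ {p q : Cell n} → GridAdj p q → GridAdj (transpose p) (transpose q)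
  transpose-adj (inj₁ (same , differ)) = inj₂ (differ , same)
  transpose-adj (inj₂ (differ , same)) = inj₁ (same , differ)

  apart : ∀ {k l i m : Fin n} → (k , l) ≢ (i , m) → ¬ GridAdj (k , l) (i , m) → k ≢ i × l ≢ m
  apart {k} {l} {i} {m} p≢q p≁q = rows-differ , columns-differ
    where
    rows-differ : k ≢ i
    rows-differ k≡i with l ≟ m
    ... | yes l≡m = p≢q (cong₂ _,_ k≡i l≡m)
    ... | no  l≢m = p≁q (inj₁ (k≡i , l≢m))
    columns-differ : l ≢ m
    columns-differ l≡m with k ≟ i
    ... | yes k≡i = p≢q (cong₂ _,_ k≡i l≡m)
    ... | no  k≢i = p≁q (inj₂ (k≢i , l≡m))

  common-neighbours : ∀ {k l i m : Fin n} → k ≢ i → l ≢ m → ∀ r → GridAdj r (k , l) → GridAdj r (i , m) →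
                      r ≡ (k , m) ⊎ r ≡ (i , l)
  common-neighbours k≢i l≢m r (inj₁ (refl , _)) (inj₁ (refl , _)) = ⊥-elim (k≢i refl)
  common-neighbours k≢i l≢m r (inj₁ (refl , _)) (inj₂ (_ , refl)) = inj₁ refl
  common-neighbours k≢i l≢m r (inj₂ (_ , refl)) (inj₁ (refl , _)) = inj₂ refl
  common-neighbours k≢i l≢m r (inj₂ (_ , refl)) (inj₂ (_ , refl)) = ⊥-elim (l≢m refl)

  -- Two distinct non-adjacent cells p, q have exactly two common neighbours:
  -- given one of them, r, there is exactly one other, r'.
  record OtherCommonNeighbour (p q r : Cell n) : Set where
    field
      r'      : Cell n
      r'≢r    : r' ≢ r
      r'~p    : GridAdj r' p
      r'~q    : GridAdj r' q
      r-or-r' : ∀ s → GridAdj s p → GridAdj s q → s ≡ r ⊎ s ≡ r'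

  other-common-neighbour : ∀ {p q r : Cell n} → p ≢ q → ¬ GridAdj p q → GridAdj r p → GridAdj r q →
                           OtherCommonNeighbour p q r
  other-common-neighbour {k , l} {i , m} {r} p≢q p≁q r~p r~q with apart p≢q p≁q
  ... | k≢i , l≢m with common-neighbours k≢i l≢m r r~p r~q
  ...   | inj₁ refl = record { r' = (i , l) ; r'≢r = λ e → k≢i (sym (cong proj₁ e))
                             ; r'~p = inj₂ (≢-sym k≢i , refl) ; r'~q = inj₁ (refl , l≢m)
                             ; r-or-r' = λ s s~p s~q → common-neighbours k≢i l≢m s s~p s~q }
  ...   | inj₂ refl = record { r' = (k , m) ; r'≢r = λ e → k≢i (cong proj₁ e)
                             ; r'~p = inj₁ (refl , ≢-sym l≢m) ; r'~q = inj₂ (k≢i , refl)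
                             ; r-or-r' = λ s s~p s~q → swap (common-neighbours k≢i l≢m s s~p s~q) }

  Apex : Cell n → Cell n → Cell n → Cell n → Set
  Apex q p₁ p₂ r = GridAdj r q × GridAdj r p₁ × GridAdj r p₂

  apex-transpose : ∀ {q p₁ p₂} → ∃! _≡_ (Apex (transpose q) (transpose p₁) (transpose p₂)) →
                   ∃! _≡_ (Apex q p₁ p₂)
  apex-transpose (r , (rq , rp₁ , rp₂) , unique) =
    transpose r , (transpose-adj rq , transpose-adj rp₁ , transpose-adj rp₂) ,
    λ (r'q , r'p₁ , r'p₂) → cong transpose (unique (transpose-adj r'q , transpose-adj r'p₁ , transpose-adj r'p₂))

  -- for an edge inside row i, the apex is the cell (i , l) in that row and in the column of q
  apex-of-row-edge : ∀ {k l i m m' : Fin n} → k ≢ i → l ≢ m → l ≢ m' → m ≢ m' →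
                     ∃! _≡_ (Apex (k , l) (i , m) (i , m'))
  apex-of-row-edge {k} {l} {i} {m} {m'} k≢i l≢m l≢m' m≢m' =
    (i , l) , (inj₂ (≢-sym k≢i , refl) , inj₁ (refl , l≢m) , inj₁ (refl , l≢m')) , unique
    where
    corner-not-adjacent : ¬ GridAdj (k , m) (i , m')
    corner-not-adjacent (inj₁ (k≡i , _))  = k≢i k≡i
    corner-not-adjacent (inj₂ (_ , m≡m')) = m≢m' m≡m'
    unique : ∀ {r} → Apex (k , l) (i , m) (i , m') r → (i , l) ≡ r
    unique {r} (rq , rp₁ , rp₂) with common-neighbours k≢i l≢m r rq rp₁
    ... | inj₁ refl = ⊥-elim (corner-not-adjacent rp₂)
    ... | inj₂ refl = refl

  apex : ∀ q p₁ p₂ → GridAdj p₁ p₂ → q ≢ p₁ → ¬ GridAdj q p₁ → q ≢ p₂ → ¬ GridAdj q p₂ →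
         ∃! _≡_ (Apex q p₁ p₂)
  apex (k , l) (i , m) (.i , m') (inj₁ (refl , m≢m')) q≢p₁ q≁p₁ q≢p₂ q≁p₂ =
    let (k≢i , l≢m) = apart q≢p₁ q≁p₁ ; (_ , l≢m') = apart q≢p₂ q≁p₂
    in apex-of-row-edge k≢i l≢m l≢m' m≢m'
  apex (k , l) (i , m) (i' , .m) (inj₂ (i≢i' , refl)) q≢p₁ q≁p₁ q≢p₂ q≁p₂ =
    let (k≢i , l≢m) = apart q≢p₁ q≁p₁ ; (k≢i' , _) = apart q≢p₂ q≁p₂
    in apex-transpose (apex-of-row-edge l≢m k≢i k≢i' i≢i')

  GridClique : (Cell n → Bool) → Set
  GridClique K = ∀ p q → K p ≡ true → K q ≡ true → p ≢ q → GridAdj p q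

  GridMaximal : (Cell n → Bool) → Set
  GridMaximal K = ∀ p → K p ≡ false → ¬ (∀ q → K q ≡ true → GridAdj p q)

  IsRow : Fin n → (Cell n → Bool) → Set
  IsRow i K = (∀ p → K p ≡ true → proj₁ p ≡ i) × (∀ j → K (i , j) ≡ true)

  clique-transpose : ∀ {K} → GridClique K → GridClique (λ p → K (transpose p))
  clique-transpose clique p q Kp Kq p≢q =
    transpose-adj (clique (transpose p) (transpose q) Kp Kq (λ e → p≢q (cong transpose e)))

  maximal-transpose : ∀ {K} → GridMaximal K → GridMaximal (λ p → K (transpose p))
  maximal-transpose maximal p Kp adjacent-to-all =
    maximal (transpose p) Kp (λ q Kq → transpose-adj (adjacent-to-all (transpose q) Kq))

  -- A maximal clique containing two cells of row i is row i: any other cell of the clique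
  -- would share a column with both, and every cell of the row is adjacent to the whole clique.
  row-through-two : ∀ {K i j j'} → GridClique K → GridMaximal K →
                    K (i , j) ≡ true → K (i , j') ≡ true → j ≢ j' → IsRow i K
  row-through-two {K} {i} {j} {j'} clique maximal Kij Kij' j≢j' = in-row , row-in
    where
    in-row : ∀ p → K p ≡ true → proj₁ p ≡ i
    in-row (k , l) Kkl with k ≟ i
    ... | yes k≡i = k≡i
    ... | no  k≢i = ⊥-elim (j≢j' (trans (sym (same-column Kij)) (same-column Kij')))
      where
      same-column : ∀ {c} → K (i , c) ≡ true → l ≡ c
      same-column {c} Kic with clique (k , l) (i , c) Kkl Kic (λ e → k≢i (cong proj₁ e))
      ... | inj₁ (k≡i , _) = ⊥-elim (k≢i k≡i)
      ... | inj₂ (_ , l≡c) = l≡c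
    row-in : ∀ l → K (i , l) ≡ true
    row-in l with K (i , l) in Kil
    ... | true  = refl
    ... | false = ⊥-elim (maximal (i , l) Kil adjacent-to-all)
      where
      adjacent-to-all : ∀ q → K q ≡ true → GridAdj (i , l) q
      adjacent-to-all (k , b) Kkb with in-row (k , b) Kkb
      ... | refl = inj₁ (refl , λ l≡b → false≢true (trans (sym Kil) (subst (λ c → K (i , c) ≡ true) (sym l≡b) Kkb)))

  maximal-clique-is-line : ∀ {K} → 2 ≤ n → GridClique K → GridMaximal K →
                           (∃ λ i → IsRow i K) ⊎ (∃ λ i → IsRow i (λ p → K (transpose p)))
  maximal-clique-is-line {K} n≥2 clique maximal with find (λ p → K p ≟ᵇ true)
  ... | inj₂ empty = ⊥-elim (maximal corner (not-true (empty corner)) (λ q Kq → ⊥-elim (empty q Kq)))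
    where
    corner : Cell n
    corner = (index n≥2 , index n≥2)
  ... | inj₁ ((i , j) , Kij) with find (λ q → (K q ≟ᵇ true) ×-dec ¬? (≡-dec _≟_ _≟_ q (i , j)))
  ...   | inj₂ singleton = ⊥-elim (maximal (i , j') Kij' (λ q Kq → adjacent-to-p q Kq))
    where
    j' : Fin n
    j' = proj₁ (another n≥2 j)
    only-p : ∀ q → K q ≡ true → q ≡ (i , j)
    only-p q Kq with ≡-dec _≟_ _≟_ q (i , j)
    ... | yes q≡p = q≡p
    ... | no  q≢p = ⊥-elim (singleton q (Kq , q≢p))
    Kij' : K (i , j') ≡ false
    Kij' = not-true λ Kij' → proj₂ (another n≥2 j) (cong proj₂ (only-p (i , j') Kij'))
    adjacent-to-p : ∀ q → K q ≡ true → GridAdj (i , j') q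
    adjacent-to-p q Kq rewrite only-p q Kq = inj₁ (refl , proj₂ (another n≥2 j))
  ...   | inj₁ ((k , l) , Kkl , kl≢ij) with clique (i , j) (k , l) Kij Kkl (λ e → kl≢ij (sym e))
  ...     | inj₁ (refl , j≢l) = inj₁ (i , row-through-two clique maximal Kij Kkl j≢l)
  ...     | inj₂ (i≢k , refl) =
    inj₂ (j , row-through-two (clique-transpose clique) (maximal-transpose maximal) Kij Kkl i≢k)

both-of-pair : ∀ {A : Set} {P : A → Set} {a b z₁ z₂ : A} → z₁ ≢ z₂ →
               z₁ ≡ a ⊎ z₁ ≡ b → z₂ ≡ a ⊎ z₂ ≡ b → P z₁ → P z₂ → P a × P b
both-of-pair z₁≢z₂ (inj₁ refl) (inj₁ refl) _ _ = ⊥-elim (z₁≢z₂ refl)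
both-of-pair z₁≢z₂ (inj₁ refl) (inj₂ refl) Pa Pb = Pa , Pb
both-of-pair z₁≢z₂ (inj₂ refl) (inj₁ refl) Pb Pa = Pa , Pb
both-of-pair z₁≢z₂ (inj₂ refl) (inj₂ refl) _ _ = ⊥-elim (z₁≢z₂ refl)

module MaximalClique (G : Graph) (n : ℕ) (n≥2 : 2 ≤ n) (locally-grid : LocallyGrid n G)
                     (C : Fin (Graph.N G) → Bool) (maximal-clique : IsMaximalClique G C) where

  open Graph G using (N; adj)
  open Grid

  Vertex : Set
  Vertex = Fin N

  _~_ : Vertex → Vertex → Set
  _~_ = Adj G

  ~-sym : ∀ {u v} → u ~ v → v ~ u
  ~-sym {u} {v} u~v = trans (Graph.sym G v u) u~v

  ~-irrefl : ∀ {u v} → u ~ v → u ≢ v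
  ~-irrefl {u} u~u refl = false≢true (trans (sym (Graph.irrefl G u)) u~u)

  clique : ∀ u v → C u ≡ true → C v ≡ true → u ≢ v → u ~ v
  clique = proj₁ maximal-clique

  maximal : ∀ v → C v ≡ false → ¬ (∀ u → C u ≡ true → v ~ u)
  maximal = proj₂ maximal-clique

  record Chart (y : Vertex) : Set where
    field
      φ         : Cell n → Vertex
      injective : ∀ p q → φ p ≡ φ q → p ≡ q
      adjacent  : ∀ p → y ~ φ p
      onto      : ∀ u → y ~ u → ∃ λ p → φ p ≡ u
      reflects  : ∀ p q → φ p ~ φ q → GridAdj p q
      preserves : ∀ p q → GridAdj p q → φ p ~ φ q

  chart : ∀ y → Chart y
  chart y =
    let (φ , injective , adjacent , onto , iso) = locally-grid y
    in record { φ = φ ; injective = injective ; adjacent = adjacent ; onto = onto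
              ; reflects = λ p q → proj₁ (iso p q) ; preserves = λ p q → proj₂ (iso p q) }

  transposed : ∀ {y} → Chart y → Chart y
  transposed ch = record
    { φ         = λ p → φ (transpose p)
    ; injective = λ p q e → cong transpose (injective (transpose p) (transpose q) e)
    ; adjacent  = λ p → adjacent (transpose p)
    ; onto      = λ u y~u → let (p , φp≡u) = onto u y~u in transpose p , φp≡u
    ; reflects  = λ p q φp~φq → transpose-adj (reflects (transpose p) (transpose q) φp~φq)
    ; preserves = λ p q p~q → preserves (transpose p) (transpose q) (transpose-adj p~q) }
    where open Chart ch

  -- For y ∈ C, the neighbours of y inside C form a full row of a suitable chart of y.
  record Line (y : Vertex) : Set where
    field
      line-chart : Chart y
      row        : Fin n
      is-row     : IsRow row (λ p → C (Chart.φ line-chart p))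

  line : ∀ y → C y ≡ true → Line y
  line y y∈C with maximal-clique-is-line n≥2 grid-clique grid-maximal
    where
    open Chart (chart y)
    grid-clique : GridClique (λ p → C (φ p))
    grid-clique p q Cp Cq p≢q = reflects p q (clique (φ p) (φ q) Cp Cq (λ e → p≢q (injective p q e)))
    grid-maximal : GridMaximal (λ p → C (φ p))
    grid-maximal p Cp adjacent-to-all = maximal (φ p) Cp adjacent-to-C
      where
      adjacent-to-C : ∀ u → C u ≡ true → φ p ~ u
      adjacent-to-C u u∈C with u ≟ y
      ... | yes refl = ~-sym (adjacent p)
      ... | no  u≢y with onto u (clique y u y∈C u∈C (≢-sym u≢y))
      ...   | q , refl = preserves p q (adjacent-to-all q u∈C)
  ... | inj₁ (i , is-row) = record { line-chart = chart y ; row = i ; is-row = is-row }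
  ... | inj₂ (i , is-row) = record { line-chart = transposed (chart y) ; row = i ; is-row = is-row }

  -- A vertex w outside C that is adjacent to y ∈ C has exactly one further neighbour y' in C:
  -- in the chart of y where C ∩ Γ(y) is a row, w lies off that row and sees only the
  -- cell of the row in its own column.
  record SecondNeighbour (w y : Vertex) : Set where
    field
      y'    : Vertex
      y'∈C  : C y' ≡ true
      y'≢y  : y' ≢ y
      w~y'  : w ~ y'
      only  : ∀ z → C z ≡ true → w ~ z → z ≡ y ⊎ z ≡ y'

  -- opaque: later proofs use only the stated properties, never the construction
  opaque
    second-neighbour : ∀ {w y} → C y ≡ true → C w ≡ false → w ~ y → SecondNeighbour w y
    second-neighbour {w} {y} y∈C w∉C w~y = from-cell (onto w (~-sym w~y))
      where
      open Line (line y y∈C)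
      open Chart line-chart
      from-cell : (∃ λ p → φ p ≡ w) → SecondNeighbour w y
      from-cell ((k , l) , refl) = record
        { y' = φ (row , l) ; y'∈C = proj₂ is-row l ; y'≢y = λ e → ~-irrefl (adjacent (row , l)) (sym e)
        ; w~y' = preserves (k , l) (row , l) (inj₂ (k≢row , refl)) ; only = only }
        where
        k≢row : k ≢ row
        k≢row refl = false≢true (trans (sym w∉C) (proj₂ is-row l))
        only : ∀ z → C z ≡ true → φ (k , l) ~ z → z ≡ y ⊎ z ≡ φ (row , l)
        only z z∈C w~z with z ≟ y
        ... | yes z≡y = inj₁ z≡y
        ... | no  z≢y with onto z (clique y z y∈C z∈C (≢-sym z≢y))
        ...   | (a , b) , refl with proj₁ is-row (a , b) z∈C | reflects (k , l) (a , b) w~z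
        ...     | refl | inj₁ (k≡row , _) = ⊥-elim (k≢row k≡row)
        ...     | refl | inj₂ (_ , refl)  = inj₂ refl

  module AroundVertex (x : Vertex) (x∉C : C x ≡ false) where

    inA : Vertex → Bool
    inA a = C a ∧ adj x a

    inD : Vertex → Bool
    inD y = C y ∧ inΓ₂ G x y

    x≢C : ∀ {y} → C y ≡ true → x ≢ y
    x≢C y∈C refl = false≢true (trans (sym x∉C) y∈C)

    D⇒C : ∀ {y} → inD y ≡ true → C y ≡ true
    D⇒C y∈D = proj₁ (∧-elim y∈D)

    D⇒x≁ : ∀ {y} → inD y ≡ true → adj x y ≡ false
    D⇒x≁ {y} y∈D =
      let (_ , y∈Γ₂)    = ∧-elim {C y} y∈D
          (_ , rest)    = ∧-elim {not ⌊ x ≟ y ⌋} y∈Γ₂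
          (x≁y , _)     = ∧-elim {not (adj x y)} rest
      in not-elim x≁y

    D-intro : ∀ {w y} → C y ≡ true → adj x y ≡ false → x ~ w → w ~ y → inD y ≡ true
    D-intro {w} {y} y∈C x≁y x~w w~y =
      ∧-intro y∈C (∧-intro (not-intro (trans (isYes≗does (x ≟ y)) (dec-false (x ≟ y) (x≢C y∈C))))
                           (∧-intro (not-intro x≁y) (any-intro _ w (∧-intro x~w w~y))))

    A∩D-empty : ∀ {a} → inA a ≡ true → ¬ (inD a ≡ true)
    A∩D-empty a∈A a∈D = false≢true (trans (sym (D⇒x≁ a∈D)) (proj₂ (∧-elim a∈A)))

    A-or-D : ∀ {w z} → C z ≡ true → x ~ w → w ~ z → inA z ≡ true ⊎ inD z ≡ true
    A-or-D {w} {z} z∈C x~w w~z with adj x z ≟ᵇ true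
    ... | yes x~z = inj₁ (∧-intro z∈C x~z)
    ... | no  x≁z = inj₂ (D-intro z∈C (not-true x≁z) x~w w~z)

    inS′ : Vertex → Bool
    inS′ = inS G x C

    record InS (w : Vertex) : Set where
      field
        x~w  : x ~ w
        w∉C  : C w ≡ false
        y₀   : Vertex
        y₀∈D : inD y₀ ≡ true
        w~y₀ : w ~ y₀

    -- opaque: later proofs use only the fields of InS, never the construction
    opaque
      S-elim : ∀ {w} → inS′ w ≡ true → InS w
      S-elim {w} w∈S =
        let (x~w , rest)       = ∧-elim {adj x w} w∈S
            (w∉C , has-D)      = ∧-elim {not (C w)} rest
            (y , y-D)          = any-witness _ has-D
            (y∈C , y-Γ₂)       = ∧-elim {C y} y-D
            (y∈Γ₂ , w~y)       = ∧-elim {inΓ₂ G x y} y-Γ₂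
        in record { x~w = x~w ; w∉C = not-elim w∉C ; y₀ = y ; y₀∈D = ∧-intro y∈C y∈Γ₂ ; w~y₀ = w~y }

    S-intro : ∀ {w y} → x ~ w → C w ≡ false → inD y ≡ true → w ~ y → inS′ w ≡ true
    S-intro {w} {y} x~w w∉C y∈D w~y =
      let (y∈C , y∈Γ₂) = ∧-elim {C y} y∈D
      in ∧-intro x~w (∧-intro (not-intro w∉C) (any-intro _ y (∧-intro y∈C (∧-intro y∈Γ₂ w~y))))

    S⇒∉C : ∀ {w} → inS′ w ≡ true → C w ≡ false
    S⇒∉C w∈S = InS.w∉C (S-elim w∈S)

    S⇒∉A : ∀ {w} → inS′ w ≡ true → inA w ≡ false
    S⇒∉A {w} w∈S = not-true λ w∈A → false≢true (trans (sym (S⇒∉C w∈S)) (proj₁ (∧-elim {C w} w∈A)))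

    sees-A : Vertex → Bool
    sees-A w = any (λ a → inA a ∧ adj w a) (allFin N)

    inSA inSD : Vertex → Bool
    inSA w = inS′ w ∧ sees-A w
    inSD w = inS′ w ∧ not (sees-A w)

    -- |A| ∈ {0, 2}: x lies outside C, so it has no or exactly two neighbours in C
    A-size : # inA ≡ 0 ⊎ # inA ≡ 2
    A-size with any? (λ a → inA a ≟ᵇ true)
    ... | no  none = inj₁ (#-none inA (λ a a∈A → none (a , a∈A)))
    ... | yes (a , a∈A) =
      let (a∈C , x~a) = ∧-elim {C a} a∈A
          open SecondNeighbour (second-neighbour a∈C x∉C x~a)
      in inj₂ (#-pair inA a y' a∈A (∧-intro y'∈C w~y') (≢-sym y'≢y)
                      (λ v v∈A → let (v∈C , x~v) = ∧-elim {C v} v∈A in only v v∈C x~v))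

    τ : Vertex → ℕ
    τ w = # (λ y → inD y ∧ (adj x w ∧ adj y w))

    #A-neighbours #D-neighbours : Vertex → ℕ
    #A-neighbours w = # (λ a → inA a ∧ adj w a)
    #D-neighbours w = # (λ y → inD y ∧ adj w y)

    τ-in-Γx : ∀ {w} → x ~ w → τ w ≡ #D-neighbours w
    τ-in-Γx {w} x~w = #-cong λ y → cong (λ b → inD y ∧ b) (trans (cong (_∧ adj y w) x~w) (Graph.sym G y w))

    -- A vertex w ∈ S has exactly two neighbours in C (second-neighbour): y₀ ∈ D and y'.
    -- Either y' ∈ A, so w ∈ S_A has one neighbour in A and one in D, or y' ∈ D, so
    -- w ∈ S_D has no neighbour in A and two in D.
    SProfile : Vertex → Set
    SProfile w = (#A-neighbours w ≡ 1 × #D-neighbours w ≡ 1 × inSA w ≡ true) ⊎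
                 (#A-neighbours w ≡ 0 × #D-neighbours w ≡ 2 × inSA w ≡ false)

    S-profile : ∀ {w} → inS′ w ≡ true → SProfile w
    S-profile {w} w∈S = by-second-neighbour (A-or-D y'∈C x~w w~y')
      where
      open InS (S-elim w∈S)
      open SecondNeighbour (second-neighbour (D⇒C y₀∈D) w∉C w~y₀)
      by-second-neighbour : inA y' ≡ true ⊎ inD y' ≡ true → SProfile w
      by-second-neighbour (inj₁ y'∈A) =
        inj₁ (#-unique (λ a → inA a ∧ adj w a) (y' , ∧-intro y'∈A w~y' , only-y') ,
              #-unique (λ y → inD y ∧ adj w y) (y₀ , ∧-intro y₀∈D w~y₀ , only-y₀) ,
              ∧-intro w∈S (any-intro (λ a → inA a ∧ adj w a) y' (∧-intro y'∈A w~y')))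
        where
        only-y' : ∀ {a} → inA a ∧ adj w a ≡ true → y' ≡ a
        only-y' {a} p with ∧-elim {inA a} p
        ... | a∈A , w~a with only a (proj₁ (∧-elim {C a} a∈A)) w~a
        ...   | inj₁ refl = ⊥-elim (A∩D-empty a∈A y₀∈D)
        ...   | inj₂ a≡y' = sym a≡y'
        only-y₀ : ∀ {y} → inD y ∧ adj w y ≡ true → y₀ ≡ y
        only-y₀ {y} p with ∧-elim {inD y} p
        ... | y∈D , w~y with only y (D⇒C y∈D) w~y
        ...   | inj₁ y≡y₀ = sym y≡y₀
        ...   | inj₂ refl = ⊥-elim (A∩D-empty y'∈A y∈D)
      by-second-neighbour (inj₂ y'∈D) =
        inj₂ (#-none (λ a → inA a ∧ adj w a) (λ a p → no-A-neighbour (a , p)) ,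
              #-pair (λ y → inD y ∧ adj w y) y₀ y' (∧-intro y₀∈D w~y₀) (∧-intro y'∈D w~y') (≢-sym y'≢y)
                     (λ y p → let (y∈D , w~y) = ∧-elim {inD y} p in only y (D⇒C y∈D) w~y) ,
              not-true λ w∈SA →
                no-A-neighbour (any-witness (λ a → inA a ∧ adj w a) (proj₂ (∧-elim {inS′ w} w∈SA))))
        where
        no-A-neighbour : ¬ (∃ λ a → inA a ∧ adj w a ≡ true)
        no-A-neighbour (a , p) with ∧-elim {inA a} p
        ... | a∈A , w~a with only a (proj₁ (∧-elim {C a} a∈A)) w~a
        ...   | inj₁ refl = A∩D-empty a∈A y₀∈D
        ...   | inj₂ refl = A∩D-empty a∈A y'∈D

    τ-witness : ∀ {w} y → inD y ∧ (adj x w ∧ adj y w) ≡ true → inD y ≡ true × w ~ y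
    τ-witness {w} y p = let (y∈D , q) = ∧-elim {inD y} p in y∈D , ~-sym (proj₂ (∧-elim {adj x w} q))

    LocalCount : Vertex → Set
    LocalCount w = τ w + ind (inSA w) ≡ ind (inA w) * # inD + 2 * ind (inS′ w)

    settle : ∀ {w t sa a s} → τ w ≡ t → inSA w ≡ sa → inA w ≡ a → inS′ w ≡ s →
             t + ind sa ≡ ind a * # inD + 2 * ind s → LocalCount w
    settle refl refl refl refl e = e

    local-count-off-Γx : ∀ {w} → adj x w ≢ true → LocalCount w
    local-count-off-Γx {w} x≁w =
      settle (#-none _ λ y p → x≁w (proj₁ (∧-elim (proj₂ (∧-elim {inD y} p)))))
             (not-true λ w∈SA → x≁w (InS.x~w (S-elim (proj₁ (∧-elim {inS′ w} w∈SA)))))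
             (not-true λ w∈A → x≁w (proj₂ (∧-elim {C w} w∈A)))
             (not-true λ w∈S → x≁w (InS.x~w (S-elim w∈S))) refl

    -- a vertex of A is adjacent to every vertex of D, as both lie in the clique C
    local-count-on-A : ∀ {w} → x ~ w → C w ≡ true → LocalCount w
    local-count-on-A {w} x~w w∈C =
      settle (#-cong λ y → ≡-from-⇔ (λ p → proj₁ (∧-elim {inD y} p))
                                    (λ y∈D → ∧-intro y∈D (∧-intro x~w (~-sym (D~w y∈D)))))
             (not-true λ w∈SA → C∩S-empty (proj₁ (∧-elim {inS′ w} w∈SA)))
             (∧-intro w∈C x~w) (not-true C∩S-empty) (sym (+-identityʳ (# inD + 0)))
      where
      C∩S-empty : inS′ w ≢ true
      C∩S-empty w∈S = false≢true (trans (sym (S⇒∉C w∈S)) w∈C)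
      D~w : ∀ {y} → inD y ≡ true → w ~ y
      D~w {y} y∈D = clique w y w∈C (D⇒C y∈D) λ { refl → false≢true (trans (sym (D⇒x≁ y∈D)) x~w) }

    local-count-off-S : ∀ {w} → x ~ w → C w ≡ false → inS′ w ≢ true → LocalCount w
    local-count-off-S {w} x~w w∉C w∉S =
      settle (#-none _ λ y p → let (y∈D , w~y) = τ-witness y p in w∉S (S-intro x~w w∉C y∈D w~y))
             (not-true λ w∈SA → w∉S (proj₁ (∧-elim {inS′ w} w∈SA)))
             (not-true λ w∈A → false≢true (trans (sym w∉C) (proj₁ (∧-elim {C w} w∈A))))
             (not-true w∉S) refl

    -- a vertex of S has one neighbour in D and one in A (w ∈ S_A), or two in D (w ∈ S_D)
    local-count-on-S : ∀ {w} → inS′ w ≡ true → LocalCount w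
    local-count-on-S {w} w∈S with S-profile w∈S | τ-in-Γx (InS.x~w (S-elim w∈S))
    ... | inj₁ (_ , one-in-D , w∈SA) | τ≡#D = settle (trans τ≡#D one-in-D) w∈SA (S⇒∉A w∈S) w∈S refl
    ... | inj₂ (_ , two-in-D , w∉SA) | τ≡#D = settle (trans τ≡#D two-in-D) w∉SA (S⇒∉A w∈S) w∈S refl

    local-count : ∀ w → LocalCount w
    local-count w with adj x w ≟ᵇ true
    ... | no  x≁w = local-count-off-Γx x≁w
    ... | yes x~w with C w ≟ᵇ true
    ...   | yes w∈C = local-count-on-A x~w w∈C
    ...   | no  w∉C with inS′ w ≟ᵇ true
    ...     | yes w∈S = local-count-on-S w∈S
    ...     | no  w∉S = local-count-off-S x~w (not-true w∉C) w∉S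

    Connects : Vertex → Vertex → Vertex → Bool
    Connects a y w = (adj x w ∧ not (C w)) ∧ ((inA a ∧ adj w a) ∧ (inD y ∧ adj w y))

    -- In the chart of a,
    -- x and y are distinct and non-adjacent, so they have two common neighbours in Γ(a);
    -- one of them is the second neighbour a' of x in C, the other is the connector.
    unique-connector : ∀ {a y} → inA a ≡ true → inD y ≡ true → ∃! _≡_ (λ w → Connects a y w ≡ true)
    unique-connector {a} {y} a∈A y∈D = connector (onto x (~-sym x~a)) (onto y a~y) (onto a' a~a')
      where
      a∈C : C a ≡ true
      a∈C = proj₁ (∧-elim {C a} a∈A)
      x~a : x ~ a
      x~a = proj₂ (∧-elim {C a} a∈A)
      y∈C : C y ≡ true
      y∈C = D⇒C y∈D
      x≁y : ¬ (x ~ y)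
      x≁y x~y = false≢true (trans (sym (D⇒x≁ y∈D)) x~y)
      open Chart (chart a)
      open SecondNeighbour (second-neighbour a∈C x∉C x~a)
        renaming (y' to a'; y'∈C to a'∈C; y'≢y to a'≢a; w~y' to x~a'; only to C-neighbours-of-x)
      a~y : a ~ y
      a~y = clique a y a∈C y∈C λ { refl → A∩D-empty a∈A y∈D }
      a~a' : a ~ a'
      a~a' = clique a a' a∈C a'∈C (≢-sym a'≢a)
      a'~y : a' ~ y
      a'~y = clique a' y a'∈C y∈C λ { refl → x≁y x~a' }
      connector : (∃ λ p → φ p ≡ x) → (∃ λ q → φ q ≡ y) → (∃ λ r → φ r ≡ a') →
                  ∃! _≡_ (λ w → Connects a y w ≡ true)
      connector (p , refl) (q , refl) (r , φr≡a') = φ r' , connects , λ {w} → unique {w}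
        where
        p≢q : p ≢ q
        p≢q e = x≢C y∈C (cong φ e)
        x~φr : x ~ φ r
        x~φr = subst (x ~_) (sym φr≡a') x~a'
        φr~y : φ r ~ y
        φr~y = subst (_~ y) (sym φr≡a') a'~y
        open OtherCommonNeighbour (other-common-neighbour p≢q (λ g → x≁y (preserves p q g))
                                                          (reflects r p (~-sym x~φr)) (reflects r q φr~y))
        x~w : x ~ φ r'
        x~w = ~-sym (preserves r' p r'~p)
        w∉C : C (φ r') ≡ false
        w∉C = not-true λ w∈C → case C-neighbours-of-x (φ r') w∈C x~w of λ
          { (inj₁ w≡a)  → ~-irrefl (adjacent r') (sym w≡a)
          ; (inj₂ w≡a') → r'≢r (injective r' r (trans w≡a' (sym φr≡a'))) }
        connects : Connects a y (φ r') ≡ true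
        connects = ∧-intro (∧-intro x~w (not-intro w∉C))
                           (∧-intro (∧-intro a∈A (~-sym (adjacent r'))) (∧-intro y∈D (preserves r' q r'~q)))
        -- any connector is a common neighbour of x and y in Γ(a) other than a' ∈ C
        from-cell : ∀ {w} → (∃ λ s → φ s ≡ w) → x ~ w → C w ≡ false → w ~ y → φ r' ≡ w
        from-cell (s , refl) x~s s∉C s~y with r-or-r' s (reflects s p (~-sym x~s)) (reflects s q s~y)
        ... | inj₁ refl = ⊥-elim (false≢true (trans (sym s∉C) (subst (λ v → C v ≡ true) (sym φr≡a') a'∈C)))
        ... | inj₂ refl = refl
        unique : ∀ {w} → Connects a y w ≡ true → φ r' ≡ w
        unique {w} c =
          let (outer , inner)   = ∧-elim {adj x w ∧ not (C w)} c
              (x~w′ , w∉C′)     = ∧-elim {adj x w} outer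
              (a-part , y-part) = ∧-elim {inA a ∧ adj w a} inner
          in from-cell (onto w (~-sym (proj₂ (∧-elim {inA a} a-part))))
                       x~w′ (not-elim w∉C′) (proj₂ (∧-elim {inD y} y-part))

    connected-pairs-at : ∀ w → ∑[ a < N ] ∑[ y < N ] ind (Connects a y w) ≡ ind (inSA w)
    connected-pairs-at w with (adj x w ∧ not (C w)) ≟ᵇ true
    ... | no not-Γx∖C =
      trans (trans (sum-cong-≗ λ a → #-none (λ y → Connects a y w) λ y c → not-Γx∖C (proj₁ (∧-elim c)))
                   (sum-replicate-zero N))
            (cong ind (sym (not-true λ w∈SA → not-Γx∖C (in-Γx∖C (S-elim (proj₁ (∧-elim {inS′ w} w∈SA)))))))
      where
      in-Γx∖C : InS w → adj x w ∧ not (C w) ≡ true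
      in-Γx∖C s = ∧-intro (InS.x~w s) (not-intro (InS.w∉C s))
    ... | yes Γx∖C = trans (sum-cong-≗ λ a → sum-cong-≗ λ y →
                             cong (λ b → ind (b ∧ ((inA a ∧ adj w a) ∧ (inD y ∧ adj w y)))) Γx∖C)
                           (trans (#-pairs (λ a → inA a ∧ adj w a) (λ y → inD y ∧ adj w y)) product)
      where
      x~w : x ~ w
      x~w = proj₁ (∧-elim {adj x w} Γx∖C)
      w∉C : C w ≡ false
      w∉C = not-elim (proj₂ (∧-elim {adj x w} Γx∖C))
      product : #A-neighbours w * #D-neighbours w ≡ ind (inSA w)
      product with inS′ w ≟ᵇ true
      ... | yes w∈S with S-profile w∈S
      ...   | inj₁ (one-A , one-D , w∈SA)  rewrite one-A | one-D | w∈SA  = refl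
      ...   | inj₂ (no-A  , _ , w∉SA)      rewrite no-A | w∉SA           = refl
      product | no w∉S
        rewrite #-none (λ y → inD y ∧ adj w y)
                       (λ y p → let (y∈D , w~y) = ∧-elim {inD y} p in w∉S (S-intro x~w w∉C y∈D w~y))
              | *-zeroʳ (#A-neighbours w) = cong ind (sym (not-true λ w∈SA → w∉S (proj₁ (∧-elim {inS′ w} w∈SA))))

    -- |S_A| = |A|·|D|: both count the triples (a , y , w) in which w connects a ∈ A and y ∈ D.
    SA-size : # inSA ≡ # inA * # inD
    SA-size = begin
      # inSA                                                ≡⟨ sum-cong-≗ (λ w → sym (connected-pairs-at w)) ⟩
      ∑[ w < N ] ∑[ a < N ] ∑[ y < N ] ind (Connects a y w) ≡⟨ ∑-comm (λ w a → ∑[ y < N ] ind (Connects a y w)) ⟩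
      ∑[ a < N ] ∑[ w < N ] ∑[ y < N ] ind (Connects a y w) ≡⟨ sum-cong-≗ (λ a → ∑-comm (λ w y → ind (Connects a y w))) ⟩
      ∑[ a < N ] ∑[ y < N ] # (Connects a y)                ≡⟨ sum-cong-≗ (λ a → sum-cong-≗ (λ y → sym (one-connector a y))) ⟩
      ∑[ a < N ] ∑[ y < N ] ind (inA a ∧ inD y)            ≡⟨ #-pairs inA inD ⟩
      # inA * # inD                                         ∎
      where
      open ≡-Reasoning
      one-connector : ∀ a y → ind (inA a ∧ inD y) ≡ # (Connects a y)
      one-connector a y = ind-as-# (inA a ∧ inD y) (Connects a y)
        (λ a∈A∧y∈D → let (a∈A , y∈D) = ∧-elim {inA a} a∈A∧y∈D in unique-connector a∈A y∈D)
        (λ w c → let (_ , pair-part) = ∧-elim {adj x w ∧ not (C w)} c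
                     (a-part , y-part) = ∧-elim {inA a ∧ adj w a} pair-part
                 in ∧-intro (proj₁ (∧-elim {inA a} a-part)) (proj₁ (∧-elim {inD y} y-part)))

    common-D-pair : Vertex → Vertex → Bool
    common-D-pair w v = any (λ y → inD y ∧ (adj w y ∧ (adj v y ∧ any (λ y' → inD y' ∧
                          (not (does (y ≟ y')) ∧ (adj w y' ∧ adj v y'))) (allFin N)))) (allFin N)

    record CommonDPair (w v : Vertex) : Set where
      field
        z₁ z₂         : Vertex
        z₁∈D          : inD z₁ ≡ true
        z₂∈D          : inD z₂ ≡ true
        z₁≢z₂         : z₁ ≢ z₂
        w~z₁          : w ~ z₁
        v~z₁          : v ~ z₁
        w~z₂          : w ~ z₂
        v~z₂          : v ~ z₂

    common-D-pair-intro : ∀ {w v} → CommonDPair w v → common-D-pair w v ≡ true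
    common-D-pair-intro {w} {v} c = any-intro _ z₁ (∧-intro z₁∈D (∧-intro w~z₁ (∧-intro v~z₁
      (any-intro _ z₂ (∧-intro z₂∈D (∧-intro (not-intro (dec-false (z₁ ≟ z₂) z₁≢z₂)) (∧-intro w~z₂ v~z₂)))))))
      where open CommonDPair c

    common-D-pair-elim : ∀ {w v} → common-D-pair w v ≡ true → CommonDPair w v
    common-D-pair-elim {w} {v} c =
      let (z₁ , p)         = any-witness _ c
          (z₁∈D , p₁)      = ∧-elim {inD z₁} p
          (w~z₁ , p₂)      = ∧-elim {adj w z₁} p₁
          (v~z₁ , p₃)      = ∧-elim {adj v z₁} p₂
          (z₂ , q)         = any-witness _ p₃
          (z₂∈D , q₁)      = ∧-elim {inD z₂} q
          (z₁≠z₂ , q₂)     = ∧-elim {not (does (z₁ ≟ z₂))} q₁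
          (w~z₂ , v~z₂)    = ∧-elim {adj w z₂} q₂
      in record { z₁ = z₁ ; z₂ = z₂ ; z₁∈D = z₁∈D ; z₂∈D = z₂∈D
                ; z₁≢z₂ = λ e → false≢true (trans (sym (not-elim z₁≠z₂)) (dec-true (z₁ ≟ z₂) e))
                ; w~z₁ = w~z₁ ; v~z₁ = v~z₁ ; w~z₂ = w~z₂ ; v~z₂ = v~z₂ }

    common-D-pair-sym : ∀ {w v} → CommonDPair w v → CommonDPair v w
    common-D-pair-sym c = record { z₁ = z₁ ; z₂ = z₂ ; z₁∈D = z₁∈D ; z₂∈D = z₂∈D ; z₁≢z₂ = z₁≢z₂
                                 ; w~z₁ = v~z₁ ; v~z₁ = w~z₁ ; w~z₂ = v~z₂ ; v~z₂ = w~z₂ }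
      where open CommonDPair c

    record DPair (w y₀ y₁ : Vertex) : Set where
      field
        y₀∈D  : inD y₀ ≡ true
        y₁∈D  : inD y₁ ≡ true
        y₀≢y₁ : y₀ ≢ y₁
        w~y₀  : w ~ y₀
        w~y₁  : w ~ y₁
        only  : ∀ z → C z ≡ true → w ~ z → z ≡ y₀ ⊎ z ≡ y₁

    SD-elim : ∀ {w} → inSD w ≡ true → x ~ w × C w ≡ false × ∃ λ y₀ → ∃ λ y₁ → DPair w y₀ y₁
    SD-elim {w} w∈SD = by-second-neighbour (A-or-D y'∈C x~w w~y')
      where
      w∈S : inS′ w ≡ true
      w∈S = proj₁ (∧-elim {inS′ w} w∈SD)
      no-A : sees-A w ≡ false
      no-A = not-elim (proj₂ (∧-elim {inS′ w} w∈SD))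
      open InS (S-elim w∈S)
      open SecondNeighbour (second-neighbour (D⇒C y₀∈D) w∉C w~y₀)
      by-second-neighbour : inA y' ≡ true ⊎ inD y' ≡ true →
                            x ~ w × C w ≡ false × ∃ λ y₀ → ∃ λ y₁ → DPair w y₀ y₁
      by-second-neighbour (inj₁ y'∈A) =
        ⊥-elim (false≢true (trans (sym no-A) (any-intro _ y' (∧-intro y'∈A w~y'))))
      by-second-neighbour (inj₂ y'∈D) = x~w , w∉C , y₀ , y' ,
        record { y₀∈D = y₀∈D ; y₁∈D = y'∈D ; y₀≢y₁ = ≢-sym y'≢y
               ; w~y₀ = w~y₀ ; w~y₁ = w~y' ; only = only }

    -- a vertex of Γ(x) \ C adjacent to two distinct vertices of D lies in S_D:
    -- these are its two neighbours in C, so it has none in A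
    SD-intro : ∀ {v y₀ y₁} → x ~ v → C v ≡ false → inD y₀ ≡ true → inD y₁ ≡ true → y₀ ≢ y₁ →
               v ~ y₀ → v ~ y₁ → inSD v ≡ true
    SD-intro {v} {y₀} {y₁} x~v v∉C y₀∈D y₁∈D y₀≢y₁ v~y₀ v~y₁ =
      ∧-intro (S-intro x~v v∉C y₀∈D v~y₀)
              (not-intro (not-true λ sees → no-A-neighbour (any-witness _ sees)))
      where
      open SecondNeighbour (second-neighbour (D⇒C y₀∈D) v∉C v~y₀)
      no-A-neighbour : ¬ (∃ λ a → inA a ∧ adj v a ≡ true)
      no-A-neighbour (a , p) with ∧-elim {inA a} p
      ... | a∈A , v~a with only a (proj₁ (∧-elim {C a} a∈A)) v~a | only y₁ (D⇒C y₁∈D) v~y₁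
      ...   | inj₁ refl | _          = A∩D-empty a∈A y₀∈D
      ...   | inj₂ refl | inj₁ refl  = y₀≢y₁ refl
      ...   | inj₂ refl | inj₂ refl  = A∩D-empty a∈A y₁∈D

    -- the matching on S_D: adjacent vertices of S_D with two common neighbours in D
    Matched : Vertex → Vertex → Bool
    Matched w v = inSD w ∧ (inSD v ∧ (adj w v ∧ common-D-pair w v))

    Matched-sym : ∀ w v → Matched w v ≡ Matched v w
    Matched-sym w v = ≡-from-⇔ flip flip
      where
      flip : ∀ {w v} → Matched w v ≡ true → Matched v w ≡ true
      flip {w} {v} m =
        let (w∈SD , m₁) = ∧-elim {inSD w} m
            (v∈SD , m₂) = ∧-elim {inSD v} m₁
            (w~v , c)   = ∧-elim {adj w v} m₂
        in ∧-intro v∈SD (∧-intro w∈SD (∧-intro (~-sym w~v)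
             (common-D-pair-intro (common-D-pair-sym (common-D-pair-elim c)))))

    Matched-irrefl : ∀ w → Matched w w ≡ false
    Matched-irrefl w = not-true λ m →
      let (_ , m₁) = ∧-elim {inSD w} m ; (_ , m₂) = ∧-elim {inSD w} m₁ ; (w~w , _) = ∧-elim {adj w w} m₂
      in ~-irrefl w~w refl

    -- With x, y₀, y₁ (the neighbours of w in C)
    -- placed in the chart of w, y₀y₁ is an edge of the grid not adjacent to x, and the partner
    -- is the apex of the triangle: the unique vertex of Γ(w) adjacent to x, y₀ and y₁.
    SD-partner : ∀ {w} → inSD w ≡ true → ∃! _≡_ (λ v → Matched w v ≡ true)
    SD-partner {w} w∈SD =
      let (x~w , _ , y₀ , y₁ , pair) = SD-elim w∈SD
      in partner pair (onto x (~-sym x~w)) (onto y₀ (DPair.w~y₀ pair)) (onto y₁ (DPair.w~y₁ pair))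
      where
      open Chart (chart w)
      partner : ∀ {y₀ y₁} → DPair w y₀ y₁ →
                (∃ λ q → φ q ≡ x) → (∃ λ p₁ → φ p₁ ≡ y₀) → (∃ λ p₂ → φ p₂ ≡ y₁) →
                ∃! _≡_ (λ v → Matched w v ≡ true)
      partner pair (q , refl) (p₁ , refl) (p₂ , refl) =
        from-apex (apex q p₁ p₂ (reflects p₁ p₂ (clique _ _ (D⇒C y₀∈D) (D⇒C y₁∈D) y₀≢y₁))
                        (proj₁ (apart-from-x y₀∈D)) (proj₂ (apart-from-x y₀∈D))
                        (proj₁ (apart-from-x y₁∈D)) (proj₂ (apart-from-x y₁∈D)))
        where
        open DPair pair
        apart-from-x : ∀ {p} → inD (φ p) ≡ true → q ≢ p × ¬ GridAdj q p
        apart-from-x y∈D = (λ e → x≢C (D⇒C y∈D) (cong φ e)) ,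
                           (λ g → false≢true (trans (sym (D⇒x≁ y∈D)) (preserves q _ g)))
        from-apex : ∃! _≡_ (Apex q p₁ p₂) → ∃! _≡_ (λ v → Matched w v ≡ true)
        from-apex (r , (r~q , r~p₁ , r~p₂) , apex-unique) = φ r , matched , λ {v} → unique {v}
          where
          x~v : x ~ φ r
          x~v = ~-sym (preserves r q r~q)
          v~y₀ : φ r ~ φ p₁
          v~y₀ = preserves r p₁ r~p₁
          v~y₁ : φ r ~ φ p₂
          v~y₁ = preserves r p₂ r~p₂
          v∉C : C (φ r) ≡ false
          v∉C = not-true λ v∈C → case only (φ r) v∈C (adjacent r) of λ
            { (inj₁ v≡y₀) → ~-irrefl v~y₀ v≡y₀
            ; (inj₂ v≡y₁) → ~-irrefl v~y₁ v≡y₁ }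
          matched : Matched w (φ r) ≡ true
          matched = ∧-intro w∈SD (∧-intro (SD-intro x~v v∉C y₀∈D y₁∈D y₀≢y₁ v~y₀ v~y₁)
            (∧-intro (adjacent r) (common-D-pair-intro record
              { z₁ = φ p₁ ; z₂ = φ p₂ ; z₁∈D = y₀∈D ; z₂∈D = y₁∈D ; z₁≢z₂ = y₀≢y₁
              ; w~z₁ = w~y₀ ; v~z₁ = v~y₀ ; w~z₂ = w~y₁ ; v~z₂ = v~y₁ })))
          from-cell : ∀ {v} → (∃ λ s → φ s ≡ v) → x ~ v → v ~ φ p₁ → v ~ φ p₂ → φ r ≡ v
          from-cell (s , refl) x~s s~y₀ s~y₁ =
            cong φ (apex-unique (reflects s q (~-sym x~s) , reflects s p₁ s~y₀ , reflects s p₂ s~y₁))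
          -- a partner v of w has two common neighbours with w in D; these must be y₀ and y₁
          unique : ∀ {v} → Matched w v ≡ true → φ r ≡ v
          unique {v} m =
            let (_ , m₁)      = ∧-elim {inSD w} m
                (v∈SD , m₂)   = ∧-elim {inSD v} m₁
                (w~v , c)     = ∧-elim {adj w v} m₂
                open CommonDPair (common-D-pair-elim c)
                (v~y₀ , v~y₁) = both-of-pair {P = v ~_} z₁≢z₂ (only z₁ (D⇒C z₁∈D) w~z₁)
                                                         (only z₂ (D⇒C z₂∈D) w~z₂) v~z₁ v~z₂
            in from-cell (onto v w~v) (proj₁ (SD-elim v∈SD)) v~y₀ v~y₁

    SD-even : ∃ λ K → # inSD ≡ K + K
    SD-even = perfect-matching-even inSD Matched Matched-sym Matched-irrefl
                (λ w → SD-partner) (λ w v m → proj₁ (∧-elim {inSD w} m))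

    sumC₂-as-τ : sumC₂ G x C ≡ ∑[ w < N ] τ w
    sumC₂-as-τ = begin
      sumC₂ G x C                                              ≡⟨ sum-allFin N _ ⟩
      ∑[ y < N ] (if inD y then c₂ G x y else 0)               ≡⟨ sum-cong-≗ (λ y → cong (λ k → if inD y then k else 0)
                                                                                       (sum-allFin N _)) ⟩
      ∑[ y < N ] (if inD y then # (λ w → adj x w ∧ adj y w) else 0)
                                                               ≡⟨ sum-cong-≗ (λ y → restrict (inD y)) ⟩
      ∑[ y < N ] ∑[ w < N ] ind (inD y ∧ (adj x w ∧ adj y w)) ≡⟨ ∑-comm (λ y w → ind (inD y ∧ (adj x w ∧ adj y w))) ⟩
      ∑[ w < N ] τ w                                           ∎
      where
      open ≡-Reasoning
      restrict : ∀ {y} b → (if b then # (λ w → adj x w ∧ adj y w) else 0) ≡ # (λ w → b ∧ (adj x w ∧ adj y w))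
      restrict true  = refl
      restrict {y} false = sym (#-none (λ w → false ∧ (adj x w ∧ adj y w)) (λ w ()))

    -- summing the local counts: Σ_w τ(w) + |S_A| = |A|·|D| + 2|S|, and |S_A| = |A|·|D|
    twice-S : 2 * # inS′ ≡ ∑[ w < N ] τ w
    twice-S = +-cancelˡ-≡ (# inA * # inD) _ _ (begin
      # inA * # inD + 2 * # inS′                               ≡⟨ cong₂ _+_ (*-distribʳ-sum (# inD) (λ w → ind (inA w)))
                                                                            (*-distribˡ-sum 2 (λ w → ind (inS′ w))) ⟩
      ∑[ w < N ] (ind (inA w) * # inD) + ∑[ w < N ] (2 * ind (inS′ w))
                                                               ≡⟨ sym (∑-distrib-+ (λ w → ind (inA w) * # inD) (λ w → 2 * ind (inS′ w))) ⟩
      ∑[ w < N ] (ind (inA w) * # inD + 2 * ind (inS′ w))     ≡⟨ sum-cong-≗ (λ w → sym (local-count w)) ⟩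
      ∑[ w < N ] (τ w + ind (inSA w))                          ≡⟨ ∑-distrib-+ τ (λ w → ind (inSA w)) ⟩
      ∑[ w < N ] τ w + # inSA                                  ≡⟨ cong (∑[ w < N ] τ w +_) SA-size ⟩
      ∑[ w < N ] τ w + # inA * # inD                           ≡⟨ +-comm (∑[ w < N ] τ w) (# inA * # inD) ⟩
      # inA * # inD + ∑[ w < N ] τ w                           ∎)
      where open ≡-Reasoning

    S-size : # inS′ ≡ # inA * # inD + # inSD
    S-size = trans (#-split inS′ sees-A) (cong (_+ # inSD) SA-size)

four-divides : ∀ a d K → a ≡ 0 ⊎ a ≡ 2 → 4 ∣ 2 * (a * d + (K + K))
four-divides a d K (inj₁ refl) = divides K (a≡0-case d K)
  where
  a≡0-case : ∀ d K → 2 * (0 * d + (K + K)) ≡ K * 4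
  a≡0-case = solve-∀
four-divides a d K (inj₂ refl) = divides (d + K) (a≡2-case d K)
  where
  a≡2-case : ∀ d K → 2 * (2 * d + (K + K)) ≡ (d + K) * 4
  a≡2-case = solve-∀

-- Corollary 5.2.
corollary5p2 : (G : Graph) (n : ℕ) → 3 ≤ n → LocallyGrid n G →
    (x : Fin (Graph.N G)) (C : Fin (Graph.N G) → Bool) →
    IsMaximalClique G C → DistToCliqueIn12 G x C →
    (2 * count G (inS G x C) ≡ sumC₂ G x C) × (4 ∣ sumC₂ G x C)
corollary5p2 G n n≥3 locally-grid x C maximal-clique (x-outside-C , _) = twice-S-is-sumC₂ , divisible
  where
  open Graph G using (N)
  open MaximalClique G n (<⇒≤ n≥3) locally-grid C maximal-clique
  open AroundVertex x (not-true λ x∈C → x-outside-C x x∈C refl)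
  open ≡-Reasoning
  twice-#S : 2 * # inS′ ≡ sumC₂ G x C
  twice-#S = trans twice-S (sym sumC₂-as-τ)
  twice-S-is-sumC₂ : 2 * count G (inS G x C) ≡ sumC₂ G x C
  twice-S-is-sumC₂ = trans (cong (2 *_) (sum-allFin N _)) twice-#S
  -- 2|S| = 2(|A|·|D| + |S_D|) with |A| ∈ {0, 2} and |S_D| even
  divisible : 4 ∣ sumC₂ G x C
  divisible = subst (4 ∣_) decomposition (four-divides (# inA) (# inD) K A-size)
    where
    K : ℕ
    K = proj₁ SD-even
    decomposition : 2 * (# inA * # inD + (K + K)) ≡ sumC₂ G x C
    decomposition = begin
      2 * (# inA * # inD + (K + K)) ≡⟨ cong (λ s → 2 * (# inA * # inD + s)) (sym (proj₂ SD-even)) ⟩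
      2 * (# inA * # inD + # inSD)  ≡⟨ cong (2 *_) (sym S-size) ⟩
      2 * # inS′                    ≡⟨ twice-#S ⟩
      sumC₂ G x C                   ∎
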